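{- Let $p,q\in\mathbb{Q}$ with $p+q\neq 0$ and $|p-q|\neq 2$. Then there are rational numbers $R,S,T$ with $R\neq 0$ such that $$\frac{R^2-S^2+1}{2R}=p\qquad\text{and}\qquad \frac{R^2-T^2+1}{2R}=q.$$ -}

module Defs where

open import Data.Rational using (ℚ; 0ℚ; 1ℚ; _+_; _*_; _÷_; 1/_; ≢-nonZero; NonZero)
open import Data.Rational.Properties using (*-assoc; *-zeroʳ; *-inverseˡ; *-identityˡ)
open import Relation.Binary.PropositionalEquality

2ℚ : ℚ
2ℚ = 1ℚ + 1ℚ

2R≢0 : (R : ℚ) → R ≢ 0ℚ → 2ℚ * R ≢ 0ℚ
2R≢0 R R≢0 eq = R≢0 (begin
    R                    ≡⟨ sym (*-identityˡ R) ⟩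
    1ℚ * R               ≡⟨ cong (_* R) (sym (*-inverseˡ 2ℚ)) ⟩
    ((1/ 2ℚ) * 2ℚ) * R   ≡⟨ *-assoc (1/ 2ℚ) 2ℚ R ⟩
    (1/ 2ℚ) * (2ℚ * R)   ≡⟨ cong ((1/ 2ℚ) *_) eq ⟩
    (1/ 2ℚ) * 0ℚ         ≡⟨ *-zeroʳ (1/ 2ℚ) ⟩
    0ℚ                   ∎)
  where open ≡-Reasoning

_/2[_,_] : ℚ → (R : ℚ) → R ≢ 0ℚ → ℚ
x /2[ R , R≢0 ] = _÷_ x (2ℚ * R) {{≢-nonZero (2R≢0 R R≢0)}}

module Submission where

-- Take S = Rh - 1 and T = Rh + 1.  Expanding the squares gives the identities
--   R² - (Rh - 1)² + 1 = R (R(1 - h²) + 2h),   R² - (Rh + 1)² + 1 = R (R(1 - h²) - 2h),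
-- so the system reduces to the two linear conditions
--   R (1 - h²) = p + q   and   2h = p - q,
-- after which the numerators become R((p+q) ± (p-q)) = 2R·p and 2R·q.
-- The second condition forces h = (p - q)/2; the hypothesis |p - q| ≠ 2 says exactly
-- that h ≠ ±1, i.e. 1 - h² ≠ 0, so R = (p + q)/(1 - h²) solves the first, and R ≠ 0
-- because p + q ≠ 0.

open import Defs
open import Data.Rational using (ℚ; 0ℚ; 1ℚ; _+_; _-_; _*_; ∣_∣; -_; 1/_; _÷_; NonZero; ≢-nonZero; _≟_)
open import Data.Rational.Properties
  using (*-assoc; *-comm; *-identityʳ; *-zeroˡ; *-inverseˡ; *-inverseʳ; +-0-group; heytingCommutativeRing; +-*-commutativeRing)
open import Data.Product using (Σ-syntax; _×_; _,_)
open import Relation.Binary.PropositionalEquality using (_≡_; _≢_; refl; sym; trans; cong; cong₂; module ≡-Reasoning)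
open import Relation.Nullary.Decidable.Core using (dec⇒maybe)
open import Algebra.Properties.Group +-0-group using (x∙y⁻¹≈ε⇒x≈y; inverseʳ-unique)
open import Algebra.Apartness.Properties.HeytingCommutativeRing heytingCommutativeRing using (x#0y#0→xy#0)
open import Tactic.RingSolver.Core.AlmostCommutativeRing using (AlmostCommutativeRing; fromCommutativeRing)
open import Tactic.RingSolver using (solve-∀)

open ≡-Reasoning

ℚ-ring : AlmostCommutativeRing _ _
ℚ-ring = fromCommutativeRing +-*-commutativeRing (λ x → dec⇒maybe (0ℚ ≟ x))

÷-*-cancel : ∀ x c .{{_ : NonZero c}} → (x ÷ c) * c ≡ x
÷-*-cancel x c = begin
  (x * 1/ c) * c    ≡⟨ *-assoc x (1/ c) c ⟩
  x * (1/ c * c)    ≡⟨ cong (x *_) (*-inverseˡ c) ⟩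
  x * 1ℚ            ≡⟨ *-identityʳ x ⟩
  x                 ∎

÷-unique : ∀ x c y .{{_ : NonZero c}} → x ≡ c * y → x ÷ c ≡ y
÷-unique x c y refl = begin
  (c * y) * 1/ c    ≡⟨ cong (_* 1/ c) (*-comm c y) ⟩
  (y * c) * 1/ c    ≡⟨ *-assoc y c (1/ c) ⟩
  y * (c * 1/ c)    ≡⟨ cong (y *_) (*-inverseʳ c) ⟩
  y * 1ℚ            ≡⟨ *-identityʳ y ⟩
  y                 ∎

÷-≢0 : ∀ x c .{{_ : NonZero c}} → x ≢ 0ℚ → x ÷ c ≢ 0ℚ
÷-≢0 x c x≢0 x÷c≡0 = x≢0 (begin
  x              ≡⟨ sym (÷-*-cancel x c) ⟩
  (x ÷ c) * c    ≡⟨ cong (_* c) x÷c≡0 ⟩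
  0ℚ * c         ≡⟨ *-zeroˡ c ⟩
  0ℚ             ∎)

-- 1 - h² = (1 - h)(1 + h) vanishes only at h = ±1 (ℚ has no zero divisors).
1-h²≢0 : ∀ h → h ≢ 1ℚ → h ≢ - 1ℚ → 1ℚ - h * h ≢ 0ℚ
1-h²≢0 h h≢1 h≢-1 1-h²≡0 = x#0y#0→xy#0 1-h≢0 1+h≢0 (trans (sym (factor h)) 1-h²≡0)
  where
  factor : ∀ x → 1ℚ - x * x ≡ (1ℚ - x) * (1ℚ + x)
  factor = solve-∀ ℚ-ring
  1-h≢0 : 1ℚ - h ≢ 0ℚ
  1-h≢0 1-h≡0 = h≢1 (sym (x∙y⁻¹≈ε⇒x≈y 1ℚ h 1-h≡0))
  1+h≢0 : 1ℚ + h ≢ 0ℚ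
  1+h≢0 1+h≡0 = h≢-1 (inverseʳ-unique 1ℚ h 1+h≡0)

numerator-minus : ∀ R h → R * R - (R * h - 1ℚ) * (R * h - 1ℚ) + 1ℚ ≡ R * (R * (1ℚ - h * h) + 2ℚ * h)
numerator-minus = solve-∀ ℚ-ring

numerator-plus : ∀ R h → R * R - (R * h + 1ℚ) * (R * h + 1ℚ) + 1ℚ ≡ R * (R * (1ℚ - h * h) - 2ℚ * h)
numerator-plus = solve-∀ ℚ-ring

sum-with-difference : ∀ R p q → R * ((p + q) + (p - q)) ≡ (2ℚ * R) * p
sum-with-difference = solve-∀ ℚ-ring

sum-minus-difference : ∀ R p q → R * ((p + q) - (p - q)) ≡ (2ℚ * R) * q
sum-minus-difference = solve-∀ ℚ-ring

solves-system : ∀ p q R h (R≢0 : R ≢ 0ℚ) → R * (1ℚ - h * h) ≡ p + q → 2ℚ * h ≡ p - q →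
  (((R * R - (R * h - 1ℚ) * (R * h - 1ℚ)) + 1ℚ) /2[ R , R≢0 ] ≡ p)
  × (((R * R - (R * h + 1ℚ) * (R * h + 1ℚ)) + 1ℚ) /2[ R , R≢0 ] ≡ q)
solves-system p q R h R≢0 R[1-h²]≡p+q 2h≡p-q =
  ÷-unique _ (2ℚ * R) p (begin
    R * R - (R * h - 1ℚ) * (R * h - 1ℚ) + 1ℚ   ≡⟨ numerator-minus R h ⟩
    R * (R * (1ℚ - h * h) + 2ℚ * h)            ≡⟨ cong₂ (λ a b → R * (a + b)) R[1-h²]≡p+q 2h≡p-q ⟩
    R * ((p + q) + (p - q))                    ≡⟨ sum-with-difference R p q ⟩
    (2ℚ * R) * p                               ∎) ,
  ÷-unique _ (2ℚ * R) q (begin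
    R * R - (R * h + 1ℚ) * (R * h + 1ℚ) + 1ℚ   ≡⟨ numerator-plus R h ⟩
    R * (R * (1ℚ - h * h) - 2ℚ * h)            ≡⟨ cong₂ (λ a b → R * (a - b)) R[1-h²]≡p+q 2h≡p-q ⟩
    R * ((p + q) - (p - q))                    ≡⟨ sum-minus-difference R p q ⟩
    (2ℚ * R) * q                               ∎)
  where instance _ = ≢-nonZero (2R≢0 R R≢0)

lemma2p2 : (p q : ℚ) → p + q ≢ 0ℚ → ∣ p - q ∣ ≢ 2ℚ →
    Σ[ R ∈ ℚ ] Σ[ S ∈ ℚ ] Σ[ T ∈ ℚ ] Σ[ R≢0 ∈ R ≢ 0ℚ ]
      (((R * R - S * S) + 1ℚ) /2[ R , R≢0 ] ≡ p)
      × (((R * R - T * T) + 1ℚ) /2[ R , R≢0 ] ≡ q)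
lemma2p2 p q p+q≢0 ∣p-q∣≢2 =
  R , R * h - 1ℚ , R * h + 1ℚ , R≢0 , solves-system p q R h R≢0 R[1-h²]≡p+q 2h≡p-q
  where
  h : ℚ
  h = (p - q) ÷ 2ℚ
  2h≡p-q : 2ℚ * h ≡ p - q
  2h≡p-q = trans (*-comm 2ℚ h) (÷-*-cancel (p - q) 2ℚ)
  h≢1 : h ≢ 1ℚ
  h≢1 h≡1 = ∣p-q∣≢2 (cong ∣_∣ (trans (sym 2h≡p-q) (cong (2ℚ *_) h≡1)))
  h≢-1 : h ≢ - 1ℚ
  h≢-1 h≡-1 = ∣p-q∣≢2 (cong ∣_∣ (trans (sym 2h≡p-q) (cong (2ℚ *_) h≡-1)))
  instance _ = ≢-nonZero (1-h²≢0 h h≢1 h≢-1)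
  R : ℚ
  R = (p + q) ÷ (1ℚ - h * h)
  R[1-h²]≡p+q : R * (1ℚ - h * h) ≡ p + q
  R[1-h²]≡p+q = ÷-*-cancel (p + q) (1ℚ - h * h)
  R≢0 : R ≢ 0ℚ
  R≢0 = ÷-≢0 (p + q) (1ℚ - h * h) p+q≢0
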